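{- Let $R$ be a finite, dwindling, convergent string rewriting system over a finite alphabet $\Sigma$ and let $\alpha \in \Sigma^+$ be irreducible with respect to $R$. If $W \in \Sigma^*$ is a minimal-length string such that $\alpha W \rightarrow_R^! W$, then $W_{[1]} = \alpha_{[1]}$.
   Context: A string rewriting system $R$ over $\Sigma$ is a set of rules $l \rightarrow r$ ($l,r\in\Sigma^*$), with $u \rightarrow_R v$ iff $u = xly$, $v = xry$ for some rule and $x,y\in\Sigma^*$. $R$ is convergent if terminating and confluent; dwindling if for each rule $l\rightarrow r$, $r$ is a proper prefix of $l$. A string is irreducible if no rule applies to it. $u \rightarrow_R^! v$ means $u \rightarrow_R^* v$ and $v$ is irreducible. $x_{[1]}$ denotes the first symbol of the string $x$. -}

module Defs where

open import Data.Nat using (ℕ)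
open import Data.Fin using (Fin)
open import Data.List using (List; []; _++_)
open import Data.List.Membership.Propositional using (_∈_)
open import Data.Product using (_×_; _,_; ∃; ∃-syntax)
open import Relation.Binary.PropositionalEquality using (_≡_; _≢_)
open import Relation.Binary.Construct.Closure.ReflexiveTransitive using (Star)
open import Induction.WellFounded using (WellFounded)
open import Relation.Nullary using (¬_)

Alphabet : ℕ → Set
Alphabet k = Fin k

Str : ℕ → Set
Str k = List (Alphabet k)

SRS : ℕ → Set
SRS k = List (Str k × Str k)

module _ {k : ℕ} (R : SRS k) where

  Step : Str k → Str k → Set
  Step u v = ∃[ x ] ∃[ y ] ∃[ l ] ∃[ r ]
    ((l , r) ∈ R × u ≡ x ++ l ++ y × v ≡ x ++ r ++ y)

  Steps : Str k → Str k → Set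
  Steps = Star Step

  Irreducible : Str k → Set
  Irreducible u = ∀ v → ¬ Step u v

  NormalForm : Str k → Str k → Set
  NormalForm u v = Steps u v × Irreducible v

  Terminating : Set
  Terminating = WellFounded (λ v u → Step u v)

  Confluent : Set
  Confluent = ∀ u v w → Steps u v → Steps u w → ∃[ z ] (Steps v z × Steps w z)

  Convergent : Set
  Convergent = Terminating × Confluent

  ProperPrefix : Str k → Str k → Set
  ProperPrefix r l = ∃[ s ] (s ≢ [] × l ≡ r ++ s)

  Dwindling : Set
  Dwindling = ∀ {l r} → (l , r) ∈ R → ProperPrefix r l

-- Normalise α W by appending the letters of W one at a time to an irreducible
-- string, starting from α. Since the rules are dwindling, a reduction of u c with
-- u irreducible must use a rule ending at c, and its result is a prefix of u. So
-- the first letter of α survives unless the irreducible string becomes empty,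
-- after which W is the normal form of a proper suffix of W. That is impossible,
-- because dwindling rules never lengthen a string.
module Submission where

open import Defs
open import Data.Nat using (ℕ; _≤_; _<_)
open import Data.Nat.Properties using (≤-refl; ≤-trans; <⇒≱; n<1+n; m<n⇒m<1+n)
open import Data.List using ([]; _∷_; _++_; _∷ʳ_; length; head; [_]; initLast; _∷ʳ′_)
open import Data.List.Properties using (++-assoc; ++-identityʳ; ∷ʳ-injectiveˡ)
open import Data.List.Relation.Binary.Sublist.Propositional using (⊆-refl)
open import Data.List.Relation.Binary.Sublist.Propositional.Properties using (++⁺; ++⁺ʳ; length-mono-≤)
open import Data.Maybe using (just)
open import Data.Maybe.Properties using (≡-dec)
open import Data.Fin.Properties using (_≟_)
open import Data.Product using (_×_; _,_; ∃-syntax)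
open import Data.Sum using (_⊎_; inj₁; inj₂; [_,_]′; map₂)
open import Data.Empty using (⊥; ⊥-elim)
open import Function using (_∘_)
open import Relation.Nullary using (¬_)
open import Relation.Nullary.Decidable using (decidable-stable)
open import Relation.Binary.PropositionalEquality using (_≡_; _≢_; refl; sym; cong; subst; module ≡-Reasoning)
open import Relation.Binary.Construct.Closure.ReflexiveTransitive using (ε; _◅_)

module _ {k : ℕ} (R : SRS k) where

  step-++ʳ : ∀ {u v} z → Step R u v → Step R (u ++ z) (v ++ z)
  step-++ʳ z (x , y , l , r , l→r , refl , refl) =
    x , y ++ z , l , r , l→r , assoc-middle l , assoc-middle r
    where
      assoc-middle : ∀ m → (x ++ m ++ y) ++ z ≡ x ++ m ++ y ++ z
      assoc-middle m = begin
        (x ++ m ++ y) ++ z  ≡⟨ ++-assoc x (m ++ y) z ⟩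
        x ++ (m ++ y) ++ z  ≡⟨ cong (x ++_) (++-assoc m y z) ⟩
        x ++ m ++ y ++ z    ∎
        where open ≡-Reasoning

  irreducible-++ˡ : ∀ u v → Irreducible R (u ++ v) → Irreducible R u
  irreducible-++ˡ u v irr t step = irr (t ++ v) (step-++ʳ v step)

  irreducible-steps-≡ : ∀ {u v} → Irreducible R u → Steps R u v → u ≡ v
  irreducible-steps-≡ irr ε          = refl
  irreducible-steps-≡ irr (step ◅ _) = ⊥-elim (irr _ step)

  normalForm-reachable : Confluent R → ∀ {u v w} →
    NormalForm R u w → Steps R u v → Steps R v w
  normalForm-reachable confluent (u→w , irr) u→v
    with z , w→z , v→z ← confluent _ _ _ u→w u→v
    rewrite irreducible-steps-≡ irr w→z = v→z

module _ {k : ℕ} (R : SRS k) (dwindling : Dwindling R) where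

  step-length-≤ : ∀ {u v} → Step R u v → length v ≤ length u
  step-length-≤ (x , y , l , r , l→r , refl , refl)
    with s , _ , refl ← dwindling l→r =
    length-mono-≤ (++⁺ (⊆-refl {x = x}) (++⁺ (++⁺ʳ s ⊆-refl) (⊆-refl {x = y})))

  steps-length-≤ : ∀ {u v} → Steps R u v → length v ≤ length u
  steps-length-≤ ε             = ≤-refl
  steps-length-≤ (step ◅ steps) = ≤-trans (steps-length-≤ steps) (step-length-≤ step)

  step-∷ʳ-prefix : ∀ {u c t} → Irreducible R u → Step R (u ∷ʳ c) t → ∃[ q ] (u ≡ t ++ q)
  step-∷ʳ-prefix {u} {c} irr (x , y , l , r , l→r , uc≡xly , refl) with initLast y
  ... | y′ ∷ʳ′ e = ⊥-elim (irr _ (x , y′ , l , r , l→r , ∷ʳ-injectiveˡ u _ uc≡ , refl))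
    where
      open ≡-Reasoning
      uc≡ : u ∷ʳ c ≡ (x ++ l ++ y′) ∷ʳ e
      uc≡ = begin
        u ∷ʳ c                ≡⟨ uc≡xly ⟩
        x ++ l ++ (y′ ∷ʳ e)   ≡⟨ cong (x ++_) (++-assoc l y′ [ e ]) ⟨
        x ++ (l ++ y′) ∷ʳ e   ≡⟨ ++-assoc x (l ++ y′) [ e ] ⟨
        (x ++ l ++ y′) ∷ʳ e   ∎
  ... | [] with dwindling l→r
  ...   | s , s≢[] , refl with initLast s
  ...     | [] = ⊥-elim (s≢[] refl)
  ...     | s′ ∷ʳ′ d = s′ , ∷ʳ-injectiveˡ u _ uc≡
    where
      open ≡-Reasoning
      uc≡ : u ∷ʳ c ≡ ((x ++ r ++ []) ++ s′) ∷ʳ d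
      uc≡ = begin
        u ∷ʳ c                       ≡⟨ uc≡xly ⟩
        x ++ (r ++ s′ ∷ʳ d) ++ []    ≡⟨ cong (x ++_) (++-identityʳ _) ⟩
        x ++ r ++ s′ ∷ʳ d            ≡⟨ cong (x ++_) (++-assoc r s′ [ d ]) ⟨
        x ++ (r ++ s′) ∷ʳ d          ≡⟨ ++-assoc x (r ++ s′) [ d ] ⟨
        (x ++ r ++ s′) ∷ʳ d          ≡⟨ cong (λ m → (x ++ m ++ s′) ∷ʳ d) (++-identityʳ r) ⟨
        (x ++ (r ++ []) ++ s′) ∷ʳ d  ≡⟨ cong (_∷ʳ d) (++-assoc x (r ++ []) s′) ⟨
        ((x ++ r ++ []) ++ s′) ∷ʳ d  ∎

  ShorterReaches : Str k → Str k → Set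
  ShorterReaches v w = ∃[ v′ ] (length v′ < length v × Steps R v′ w)

  ¬ShorterReaches-self : ∀ {w} → ¬ ShorterReaches w w
  ¬ShorterReaches-self (_ , v′<w , v′→w) = <⇒≱ v′<w (steps-length-≤ v′→w)

  shorterReaches-∷ : ∀ {v w} c → ShorterReaches v w → ShorterReaches (c ∷ v) w
  shorterReaches-∷ c (v′ , v′<v , v′→w) = v′ , m<n⇒m<1+n v′<v , v′→w

  -- Double negated because irreducibility of u ∷ʳ c is not decided.
  head-kept-or-shorterReaches : Confluent R → ∀ v {a u w} → Irreducible R (a ∷ u) →
    NormalForm R (a ∷ u ++ v) w → ¬ ¬ (head w ≡ just a ⊎ ShorterReaches v w)
  head-kept-or-shorterReaches confluent [] {u = u} irr (u→w , _) ¬goal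
    rewrite ++-identityʳ u = ¬goal (inj₁ (cong head (sym (irreducible-steps-≡ R irr u→w))))
  head-kept-or-shorterReaches confluent (c ∷ v) {a} {u} {w} irr (u→w , irr-w) ¬goal =
    head-kept-or-shorterReaches confluent v irreducible-∷ʳ (uc→w , irr-w)
      (¬goal ∘ map₂ (shorterReaches-∷ {v} c))
    where
      uc→w : Steps R ((a ∷ u ∷ʳ c) ++ v) w
      uc→w = subst (λ z → Steps R (a ∷ z) w) (sym (++-assoc u [ c ] v)) u→w

      prefix-reduct-absurd : ∀ {q} t → a ∷ u ≡ t ++ q → Steps R (t ++ v) w → ⊥
      prefix-reduct-absurd []      _    v→w  = ¬goal (inj₂ (v , n<1+n _ , v→w))
      prefix-reduct-absurd (b ∷ t) refl tv→w =
        head-kept-or-shorterReaches confluent v (irreducible-++ˡ R (b ∷ t) _ irr) (tv→w , irr-w)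
          (¬goal ∘ map₂ (shorterReaches-∷ {v} c))

      irreducible-∷ʳ : Irreducible R (a ∷ u ∷ʳ c)
      irreducible-∷ʳ t step with q , au≡tq ← step-∷ʳ-prefix irr step =
        prefix-reduct-absurd t au≡tq
          (normalForm-reachable R confluent (uc→w , irr-w) (step-++ʳ R v step ◅ ε))

lemma1p6 : {k : ℕ} (R : SRS k) → Dwindling R → Convergent R →
    (α : Str k) → α ≢ [] → Irreducible R α →
    (W : Str k) → NormalForm R (α ++ W) W →
    (∀ (W′ : Str k) → NormalForm R (α ++ W′) W′ → length W ≤ length W′) →
    head W ≡ head α
lemma1p6 R dwindling (_ , confluent) []      α≢[] _   _ _  _ = ⊥-elim (α≢[] refl)
lemma1p6 R dwindling (_ , confluent) (a ∷ α) _    irr W αW→W _ =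
  decidable-stable (≡-dec _≟_ (head W) (just a)) λ head≢a →
    head-kept-or-shorterReaches R dwindling confluent W irr αW→W
      [ head≢a , ¬ShorterReaches-self R dwindling ]′
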